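{- Let $S$ be a primitive non-powerful signed digraph of order $n$ with underlying digraph $D$. Suppose $W_1$ and $W_2$ are a pair of SSSD walks of length $r$ from a vertex $u$ to a vertex $v$. Then for every integer $k$ with $1\le k\le n$, $L(S,k) \le F(D,k) + d(D) + r$, where $d(D)$ is the diameter of $D$.
   Context: A signed digraph $S$ is a digraph (loops allowed, no multiple arcs) on a finite vertex set in which each arc is assigned a sign $1$ or $-1$; its underlying digraph is obtained by forgetting the signs, and its order is its number of vertices. A walk of length $m$ is a sequence of arcs $e_1,\dots,e_m$ such that the terminal vertex of $e_i$ is the initial vertex of $e_{i+1}$; for each vertex $u$ there is also the trivial walk of length $0$ from $u$ to $u$. The sign of a walk is the product of the signs of its arcs (the trivial walk has sign $1$). Two walks form a pair of SSSD walks if they have the same initial vertex, the same terminal vertex, the same length, but different signs. A digraph $D$ is primitive if there is a positive integer $m$ such that for every ordered pair $(u,v)$ of vertices there is a walk of length $m$ from $u$ to $v$; a signed digraph is primitive if its underlying digraph is. A signed digraph is non-powerful if it contains a pair of SSSD walks. For a primitive non-powerful signed digraph $S$ and $X \subseteq V(S)$, $l_S(X)$ is the least integer $p\ge 0$ such that for every vertex $v$ of $S$ there exist $x\in X$ and a pair of SSSD walks of length $p$ from $x$ to $v$; $L(S,k)=\max\{l_S(X) : X\subseteq V(S),\ |X|=k\}$. For a primitive digraph $D$ and $X\subseteq V(D)$, $\exp_D(X)$ is the least integer $p\ge 0$ such that for every vertex $v$ there is a walk of length $p$ from some vertex of $X$ to $v$; $F(D,k)=\max\{\exp_D(X): X\subseteq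 V(D),\ |X|=k\}$ (so $F(D,n)=0$). The diameter $d(D)$ is the maximum, over ordered pairs $(x,y)$ of vertices, of the length of a shortest walk from $x$ to $y$. -}

module Defs where

open import Data.Nat using (ℕ; zero; suc; _≤_; _<_)
open import Data.Fin using (Fin)
open import Data.Fin.Subset using (Subset; _∈_; ∣_∣)
open import Data.Bool using (Bool; true; false; T)
open import Data.Maybe using (Maybe; just; nothing; is-just)
open import Data.Sign using (Sign; _*_) renaming (+ to pos; - to neg)
open import Data.Product using (Σ; ∃; ∃-syntax; _×_; _,_)
open import Relation.Binary.PropositionalEquality using (_≡_; _≢_)

Digraph : ℕ → Set
Digraph n = Fin n → Fin n → Bool

SignedDigraph : ℕ → Set
SignedDigraph n = Fin n → Fin n → Maybe Sign

underlying : ∀ {n} → SignedDigraph n → Digraph n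
underlying S u w = is-just (S u w)

data DWalk {n : ℕ} (D : Digraph n) : Fin n → Fin n → ℕ → Set where
  dnil  : ∀ {u} → DWalk D u u 0
  dcons : ∀ {u w v m} → T (D u w) → DWalk D w v m → DWalk D u v (suc m)

data SWalk {n : ℕ} (S : SignedDigraph n) : Fin n → Fin n → ℕ → Sign → Set where
  snil  : ∀ {u} → SWalk S u u 0 pos
  scons : ∀ {u w v m s t} → S u w ≡ just s → SWalk S w v m t →
          SWalk S u v (suc m) (s * t)

SSSDPair : ∀ {n} → SignedDigraph n → Fin n → Fin n → ℕ → Set
SSSDPair S u v m =
  Σ Sign λ s → Σ Sign λ t → SWalk S u v m s × SWalk S u v m t × s ≢ t

PrimitiveD : ∀ {n} → Digraph n → Set
PrimitiveD {n} D = Σ ℕ λ m → (0 < m) × (∀ (u v : Fin n) → DWalk D u v m)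

Primitive : ∀ {n} → SignedDigraph n → Set
Primitive S = PrimitiveD (underlying S)

NonPowerful : ∀ {n} → SignedDigraph n → Set
NonPowerful {n} S = Σ (Fin n) λ u → Σ (Fin n) λ v → Σ ℕ λ m → SSSDPair S u v m

IsLeast : (ℕ → Set) → ℕ → Set
IsLeast P p = P p × (∀ q → P q → p ≤ q)

IsGreatest : (ℕ → Set) → ℕ → Set
IsGreatest P p = P p × (∀ q → P q → q ≤ p)

SSSDCovers : ∀ {n} → SignedDigraph n → Subset n → ℕ → Set
SSSDCovers {n} S X p = ∀ (v : Fin n) → Σ (Fin n) λ x → x ∈ X × SSSDPair S x v p

IsLS : ∀ {n} → SignedDigraph n → Subset n → ℕ → Set
IsLS S X = IsLeast (SSSDCovers S X)

IsL : ∀ {n} → SignedDigraph n → ℕ → ℕ → Set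
IsL {n} S k = IsGreatest (λ l → Σ (Subset n) λ X → ∣ X ∣ ≡ k × IsLS S X l)

Covers : ∀ {n} → Digraph n → Subset n → ℕ → Set
Covers {n} D X p = ∀ (v : Fin n) → Σ (Fin n) λ x → x ∈ X × DWalk D x v p

IsExp : ∀ {n} → Digraph n → Subset n → ℕ → Set
IsExp D X = IsLeast (Covers D X)

IsF : ∀ {n} → Digraph n → ℕ → ℕ → Set
IsF {n} D k = IsGreatest (λ e → Σ (Subset n) λ X → ∣ X ∣ ≡ k × IsExp D X e)

IsDist : ∀ {n} → Digraph n → Fin n → Fin n → ℕ → Set
IsDist D x y = IsLeast (DWalk D x y)

IsDiameter : ∀ {n} → Digraph n → ℕ → Set
IsDiameter {n} D = IsGreatest (λ e → Σ (Fin n) λ x → Σ (Fin n) λ y → IsDist D x y e)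

module Submission where

open import Defs
open import Data.Nat using (ℕ; zero; suc; _≤_; _<_; _+_)
open import Data.Nat.Properties using (anyUpTo?; ≮⇒≥; m≤n⇒∃[o]m+o≡n; +-identityʳ; +-suc)
open import Data.Nat.Induction using (<-wellFounded)
open import Data.Nat.Tactic.RingSolver using (solve-∀)
open import Data.Fin using (Fin; _≟_)
open import Data.Fin.Properties using (any?; all?)
open import Data.Fin.Subset using (Subset; _∈_; ∣_∣; Nonempty)
open import Data.Fin.Subset.Properties using (_∈?_; nonempty?; Empty-unique; ∣⊥∣≡0)
open import Data.Bool using (T)
open import Data.Maybe using (just)
open import Data.Sign using (Sign; _*_) renaming (+ to pos)
open import Data.Sign.Properties using (*-assoc; *-cancelˡ-≡; *-cancelʳ-≡)
open import Data.Product using (∃; ∃₂; _×_; _,_)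
open import Induction.WellFounded using (Acc; acc)
open import Relation.Nullary using (Dec; yes; no; contradiction)
open import Relation.Nullary.Decidable using (T?; _×-dec_; map′)
open import Relation.Unary using (Decidable)
open import Relation.Binary.PropositionalEquality using (_≡_; _≢_; refl; sym; trans; cong; subst)

module _ {P : ℕ → Set} (P? : Decidable P) where

  least-from-Acc : ∀ {m} → Acc _<_ m → P m → ∃ (IsLeast P)
  least-from-Acc {m} (acc rec) pm with anyUpTo? P? m
  ... | yes (q , q<m , pq) = least-from-Acc (rec q<m) pq
  ... | no ∄smaller = m , pm , λ q pq → ≮⇒≥ (λ q<m → ∄smaller (q , q<m , pq))

  least : ∀ {m} → P m → ∃ (IsLeast P)
  least {m} = least-from-Acc (<-wellFounded m)

nonempty-if-size≥1 : ∀ {n} (X : Subset n) → 1 ≤ ∣ X ∣ → Nonempty X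
nonempty-if-size≥1 {n} X 1≤∣X∣ with nonempty? X
... | yes X≠∅ = X≠∅
... | no X=∅ = contradiction (subst (1 ≤_) ∣X∣≡0 1≤∣X∣) λ ()
  where
  ∣X∣≡0 : ∣ X ∣ ≡ 0
  ∣X∣≡0 = trans (cong ∣_∣ (Empty-unique X=∅)) (∣⊥∣≡0 n)

module _ {n : ℕ} (D : Digraph n) where

  dwalk? : ∀ x y m → Dec (DWalk D x y m)
  dwalk? x y zero with x ≟ y
  ... | yes refl = yes dnil
  ... | no x≢y = no λ { dnil → x≢y refl }
  dwalk? x y (suc m) =
    map′ (λ { (w , arc , walk) → dcons arc walk }) (λ { (dcons arc walk) → _ , arc , walk })
         (any? λ w → T? (D x w) ×-dec dwalk? w y m)

  covers? : ∀ X p → Dec (Covers D X p)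
  covers? X p = all? λ v → any? λ x → (x ∈? X) ×-dec dwalk? x v p

  dwalk-unsnoc : ∀ {x y m} → DWalk D x y (suc m) → ∃ λ w → DWalk D x w m × T (D w y)
  dwalk-unsnoc (dcons arc dnil) = _ , dnil , arc
  dwalk-unsnoc (dcons arc walk@(dcons _ _)) with dwalk-unsnoc walk
  ... | w , init , last = w , dcons arc init , last

  dwalk-snoc : ∀ {x w y m} → DWalk D x w m → T (D w y) → DWalk D x y (suc m)
  dwalk-snoc dnil arc = dcons arc dnil
  dwalk-snoc (dcons arc′ walk) arc = dcons arc′ (dwalk-snoc walk arc)

  -- The closed walk of length m > 0 at v ends with an arc into v.
  in-neighbour : PrimitiveD D → ∀ v → ∃ λ w → T (D w v)
  in-neighbour (suc m , _ , walks) v with dwalk-unsnoc (walks v v)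
  ... | w , _ , arc = w , arc

  covers-suc : PrimitiveD D → ∀ {X p} → Covers D X p → Covers D X (suc p)
  covers-suc prim covers v with in-neighbour prim v
  ... | w , arc with covers w
  ...   | x , x∈X , walk = x , x∈X , dwalk-snoc walk arc

  covers-+ : PrimitiveD D → ∀ {X p} o → Covers D X p → Covers D X (p + o)
  covers-+ prim {X} {p} zero covers = subst (Covers D X) (sym (+-identityʳ p)) covers
  covers-+ prim {X} {p} (suc o) covers =
    subst (Covers D X) (sym (+-suc p o)) (covers-suc prim (covers-+ prim o covers))

  covers-mono : PrimitiveD D → ∀ {X p q} → p ≤ q → Covers D X p → Covers D X q
  covers-mono prim p≤q covers with m≤n⇒∃[o]m+o≡n p≤q
  ... | o , refl = covers-+ prim o covers

  exp-exists : PrimitiveD D → ∀ {X} → Nonempty X → ∃ (IsExp D X)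
  exp-exists (m , _ , walks) {X} (x , x∈X) = least (covers? X) {m} λ v → x , x∈X , walks x v

  covers-if-exp≤ : PrimitiveD D → ∀ {X f} → Nonempty X → (∀ e → IsExp D X e → e ≤ f) → Covers D X f
  covers-if-exp≤ prim X≠∅ exp≤f with exp-exists prim X≠∅
  ... | e , isExp@(covers , _) = covers-mono prim (exp≤f e isExp) covers

  walk-within-diameter : PrimitiveD D → ∀ {d} → (∀ e → (∃₂ λ x y → IsDist D x y e) → e ≤ d) →
                         ∀ x y → ∃ λ δ → δ ≤ d × DWalk D x y δ
  walk-within-diameter (m , _ , walks) dist≤d x y with least (dwalk? x y) (walks x y)
  ... | δ , isDist@(walk , _) = δ , dist≤d δ (x , y , isDist) , walk

module _ {n : ℕ} {S : SignedDigraph n} where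

  arc-sign : ∀ {x y} → T (underlying S x y) → ∃ λ s → S x y ≡ just s
  arc-sign {x} {y} arc with S x y
  ... | just s = s , refl

  signed-walk : ∀ {x y m} → DWalk (underlying S) x y m → ∃ (SWalk S x y m)
  signed-walk dnil = pos , snil
  signed-walk (dcons arc walk) with arc-sign arc | signed-walk walk
  ... | s , arc′ | t , walk′ = s * t , scons arc′ walk′

  swalk-++ : ∀ {x y z m m′ s t} → SWalk S x y m s → SWalk S y z m′ t → SWalk S x z (m + m′) (s * t)
  swalk-++ snil walk′ = walk′
  swalk-++ {t = t} (scons {s = s} {t = t′} arc walk) walk′ =
    subst (SWalk S _ _ _) (sym (*-assoc s t′ t)) (scons arc (swalk-++ walk walk′))

  sssd-extend : ∀ {x u v w a r b σ τ} →
                SWalk S x u a σ → SSSDPair S u v r → SWalk S v w b τ → SSSDPair S x w (a + r + b)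
  sssd-extend {σ = σ} {τ} before (s , t , W₁ , W₂ , s≢t) after =
    σ * s * τ , σ * t * τ ,
    swalk-++ (swalk-++ before W₁) after , swalk-++ (swalk-++ before W₂) after ,
    λ eq → s≢t (*-cancelˡ-≡ σ s t (*-cancelʳ-≡ τ (σ * s) (σ * t) eq))

  -- To reach w: a walk from X to u, the pair u → v, then a shortest walk v → w of length δ ≤ d.
  -- The slack d − δ is absorbed by the first leg, since X covers in every length ≥ f.
  sssd-covers : ∀ {X u v r f d} → PrimitiveD (underlying S) → SSSDPair S u v r →
                Covers (underlying S) X f → (∀ w → ∃ λ δ → δ ≤ d × DWalk (underlying S) v w δ) →
                SSSDCovers S X (f + d + r)
  sssd-covers {u = u} {r = r} {f} prim pair covers short w with short w
  ... | δ , δ≤d , after with m≤n⇒∃[o]m+o≡n δ≤d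
  ...   | o , refl with covers-+ (underlying S) prim o covers u
  ...     | x , x∈X , before with signed-walk before | signed-walk after
  ...       | _ , before′ | _ , after′ =
    x , x∈X , subst (SSSDPair S x w) (rearrange f o r δ) (sssd-extend before′ pair after′)
    where
    rearrange : ∀ f o r δ → f + o + r + δ ≡ f + (δ + o) + r
    rearrange = solve-∀

lemma3p2 : ∀ (n : ℕ) (S : SignedDigraph n) → Primitive S → NonPowerful S →
    ∀ (u v : Fin n) (r : ℕ) (s₁ s₂ : Sign) →
    SWalk S u v r s₁ → SWalk S u v r s₂ → s₁ ≢ s₂ →
    ∀ (k : ℕ) → 1 ≤ k × k ≤ n →
    ∀ (L f d : ℕ) → IsL S k L → IsF (underlying S) k f → IsDiameter (underlying S) d →
    L ≤ f + d + r
lemma3p2 n S prim _ u v r s₁ s₂ W₁ W₂ s₁≢s₂ k (1≤k , _) L f d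
         ((X , ∣X∣≡k , _ , L-least) , _) (_ , F-greatest) (_ , d-greatest) =
  L-least (f + d + r) (sssd-covers prim (s₁ , s₂ , W₁ , W₂ , s₁≢s₂) X-covers-at-f short-walks)
  where
  D = underlying S

  X≠∅ : Nonempty X
  X≠∅ = nonempty-if-size≥1 X (subst (1 ≤_) (sym ∣X∣≡k) 1≤k)

  X-covers-at-f : Covers D X f
  X-covers-at-f = covers-if-exp≤ D prim X≠∅ λ e isExp → F-greatest e (X , ∣X∣≡k , isExp)

  short-walks : ∀ w → ∃ λ δ → δ ≤ d × DWalk D v w δ
  short-walks = walk-within-diameter D prim d-greatest v
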